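{- Let $n\ge 2$. (a) If $N=n+2$, then there exist $n$ pairwise incomparable chains $\mathcal{C}_1,\dots,\mathcal{C}_n$ in $\mathcal{B}_N$ with $|\mathcal{C}_i|=i$ for $1\le i\le n$. (b) Let $m$ be a positive integer with either $m=n=2$ or $m\ge 3$, and let $N=(m-1)(n-1)+2$. Then there exist $n$ pairwise incomparable chains $\mathcal{C}_1,\dots,\mathcal{C}_n$ in $\mathcal{B}_N$ with $|\mathcal{C}_i|=(m-1)(i-1)+1$ for $1\le i\le n$.
   Context: $\mathcal{B}_N$ denotes the family of all subsets of $[N]=\{1,\dots,N\}$ ordered by inclusion. A chain in $\mathcal{B}_N$ is a family of subsets totally ordered by inclusion. Two families $\mathcal{F},\mathcal{G}$ of sets are incomparable if for every $F\in\mathcal{F}$ and $G\in\mathcal{G}$, neither $F\subseteq G$ nor $G\subseteq F$. -}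

module Defs where

open import Data.Nat using (ℕ)
open import Data.Fin using (Fin)
open import Data.Fin.Subset using (Subset; _⊆_)
open import Data.List using (List)
open import Data.List.Membership.Propositional using (_∈_)
open import Data.List.Relation.Unary.Unique.Propositional using (Unique)
open import Data.Product using (_×_)
open import Data.Sum using (_⊎_)
open import Relation.Nullary using (¬_)
open import Relation.Binary.PropositionalEquality using (_≡_)

-- B_N : subsets of [N] = Subset N (characteristic vectors), ordered by _⊆_.
-- A family of subsets is represented by a duplicate-free list; its size is the list length.

IsChain : {N : ℕ} → List (Subset N) → Set
IsChain {N} C = Unique C × (∀ {F G : Subset N} → F ∈ C → G ∈ C → F ⊆ G ⊎ G ⊆ F)

Incomparable : {N : ℕ} → List (Subset N) → List (Subset N) → Set
Incomparable {N} 𝓕 𝓖 = ∀ {F G : Subset N} → F ∈ 𝓕 → G ∈ 𝓖 → ¬ (F ⊆ G) × ¬ (G ⊆ F)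

PairwiseIncomparableChains : {N n : ℕ} → (Fin n → List (Subset N)) → Set
PairwiseIncomparableChains {N} {n} C =
  (∀ i → IsChain (C i)) × (∀ i j → ¬ (i ≡ j) → Incomparable (C i) (C j))

-- Chains are built by tagging. Prefixing every set of a family with a fixed 0/1 word
-- preserves chains and incomparability, and two families tagged with incomparable words
-- (such as 10 and 01) are incomparable. Hence two extra coordinates suffice to place a new
-- chain, of any size up to one more than the remaining coordinates, beside a family of
-- pairwise incomparable chains. For (b) this is iterated from the largest chain inwards:
-- each step uses up two coordinates while the next chain needs m - 1 ≥ 2 fewer, so
-- (m - 1)(n - 1) + 2 coordinates suffice. For (a) each step adds two coordinates and two
-- chains, of sizes n + 2 and n + 1, tagged 101 and 1100 on top of the old family tagged 01;
-- the old sets stay out of the 1100-tagged ones because every set is kept meeting the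
-- first two coordinates.
module Submission where

open import Defs
open import Data.Bool using (Bool)
open import Data.Fin using (Fin; zero; suc; toℕ; opposite)
open import Data.Fin.Properties using (opposite-prop; opposite-involutive)
open import Data.Fin.Subset using (Subset; _⊆_; _∈_; _∉_; inside; outside) renaming (⊥ to ∅)
open import Data.Fin.Subset.Properties using (s⊆s; drop-∷-⊆; ⊆-refl; ⊆-antisym; ⊆-reflexive; ⊥⊆)
open import Data.List using (List; _∷_; [_]; length; map; take)
open import Data.List.Properties using (length-map; length-take)
open import Data.List.Membership.Propositional using () renaming (_∈_ to _∈ₗ_)
open import Data.List.Membership.Propositional.Properties using (∈-map⁻)
open import Data.List.Relation.Binary.Sublist.Propositional using (lookup)
open import Data.List.Relation.Binary.Sublist.Propositional.Properties using (take-⊆)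
open import Data.List.Relation.Unary.All using (All)
import Data.List.Relation.Unary.All as All
import Data.List.Relation.Unary.All.Properties as All
open import Data.List.Relation.Unary.AllPairs using ([]; _∷_)
open import Data.List.Relation.Unary.Any using (here; there)
open import Data.List.Relation.Unary.Unique.Propositional.Properties using (map⁺; take⁺)
open import Data.Nat using (ℕ; zero; suc; _+_; _*_; _∸_; _≤_; _⊓_; z≤n; s≤s)
open import Data.Nat.Properties
  using (+-comm; +-monoˡ-≤; *-suc; *-zeroʳ; ≤-reflexive; m≤n⇒m⊓n≡m; module ≤-Reasoning)
open import Data.Product using (Σ; _×_; _,_; proj₁; proj₂; swap)
open import Data.Sum using (_⊎_; inj₁; inj₂)
import Data.Sum as Sum
open import Data.Vec using (Vec; []; _∷_; _++_; here; there)
open import Data.Vec.Functional using () renaming (_∷_ to _∷ᶠ_)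
open import Function using (_∘_)
open import Function.Definitions using (Injective)
open import Relation.Binary.PropositionalEquality using (_≡_; refl; sym; trans; cong; subst)
open import Relation.Nullary using (¬_; contradiction)

private
  variable
    k n G H : ℕ

⊈-witness : {x : Fin G} {p q : Subset G} → x ∈ p → x ∉ q → ¬ (p ⊆ q)
⊈-witness x∈p x∉q p⊆q = x∉q (p⊆q x∈p)

++-monoʳ-⊆ : (w : Vec Bool k) {s t : Subset G} → s ⊆ t → w ++ s ⊆ w ++ t
++-monoʳ-⊆ []      s⊆t = s⊆t
++-monoʳ-⊆ (_ ∷ w) s⊆t = s⊆s (++-monoʳ-⊆ w s⊆t)

++-cancelˡ-⊆ : (w : Vec Bool k) {s t : Subset G} → w ++ s ⊆ w ++ t → s ⊆ t
++-cancelˡ-⊆ []      ws⊆wt = ws⊆wt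
++-cancelˡ-⊆ (_ ∷ w) ws⊆wt = ++-cancelˡ-⊆ w (drop-∷-⊆ ws⊆wt)

module _ (f : Subset G → Subset H)
         (mono : ∀ {s t} → s ⊆ t → f s ⊆ f t)
         (cancel : ∀ {s t} → f s ⊆ f t → s ⊆ t) where

  IsChain-map : {C : List (Subset G)} → IsChain C → IsChain (map f C)
  IsChain-map {C} (unique , comparable) = map⁺ injective unique , comparable′
    where
    injective : ∀ {s t} → f s ≡ f t → s ≡ t
    injective eq = ⊆-antisym (cancel (⊆-reflexive eq)) (cancel (⊆-reflexive (sym eq)))

    comparable′ : ∀ {F F′} → F ∈ₗ map f C → F′ ∈ₗ map f C → F ⊆ F′ ⊎ F′ ⊆ F
    comparable′ F∈ F′∈ with ∈-map⁻ f F∈ | ∈-map⁻ f F′∈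
    ... | _ , s∈ , refl | _ , t∈ , refl = Sum.map mono mono (comparable s∈ t∈)

Incomparable-map₂ : (f : Subset G → Subset k) (g : Subset H → Subset k)
  {C : List (Subset G)} {D : List (Subset H)} →
  (∀ {s t} → s ∈ₗ C → t ∈ₗ D → ¬ (f s ⊆ g t) × ¬ (g t ⊆ f s)) →
  Incomparable (map f C) (map g D)
Incomparable-map₂ f g separated F∈ G∈ with ∈-map⁻ f F∈ | ∈-map⁻ g G∈
... | _ , s∈ , refl | _ , t∈ , refl = separated s∈ t∈

Incomparable-map : (f : Subset G → Subset H) → (∀ {s t} → f s ⊆ f t → s ⊆ t) →
  {C D : List (Subset G)} → Incomparable C D → Incomparable (map f C) (map f D)
Incomparable-map f cancel incomparable = Incomparable-map₂ f f λ s∈ t∈ →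
  proj₁ (incomparable s∈ t∈) ∘ cancel , proj₂ (incomparable s∈ t∈) ∘ cancel

Incomparable-sym : {C D : List (Subset G)} → Incomparable C D → Incomparable D C
Incomparable-sym incomparable F∈ G∈ = swap (incomparable G∈ F∈)

IsChain-prefix : (w : Vec Bool k) {C : List (Subset G)} → IsChain C → IsChain (map (w ++_) C)
IsChain-prefix w = IsChain-map (w ++_) (++-monoʳ-⊆ w) (++-cancelˡ-⊆ w)

Incomparable-prefix : (w : Vec Bool k) {C D : List (Subset G)} →
  Incomparable C D → Incomparable (map (w ++_) C) (map (w ++_) D)
Incomparable-prefix w = Incomparable-map (w ++_) (++-cancelˡ-⊆ w)

IsChain-take : ∀ L {C : List (Subset G)} → IsChain C → IsChain (take L C)
IsChain-take L {C} (unique , comparable) =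
  take⁺ L unique , λ F∈ F′∈ → comparable (lookup (take-⊆ L C) F∈) (lookup (take-⊆ L C) F′∈)

initialSegments : (G : ℕ) → List (Subset G)
initialSegments zero    = [ [] ]
initialSegments (suc G) = ∅ ∷ map (inside ∷_) (initialSegments G)

length-initialSegments : ∀ G → length (initialSegments G) ≡ suc G
length-initialSegments zero    = refl
length-initialSegments (suc G) =
  cong suc (trans (length-map (inside ∷_) (initialSegments G)) (length-initialSegments G))

initialSegments-isChain : ∀ G → IsChain (initialSegments G)
initialSegments-isChain zero    = (All.[] ∷ []) , λ { (here refl) (here refl) → inj₁ ⊆-refl }
initialSegments-isChain (suc G) = (All.tabulate ∅∉tail ∷ proj₁ tail-isChain) , comparable
  where
  tail-isChain : IsChain (map (inside ∷_) (initialSegments G))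
  tail-isChain = IsChain-map (inside ∷_) s⊆s drop-∷-⊆ (initialSegments-isChain G)

  ∅∉tail : ∀ {s} → s ∈ₗ map (inside ∷_) (initialSegments G) → ¬ (∅ ≡ s)
  ∅∉tail s∈ eq with ∈-map⁻ (inside ∷_) s∈
  ∅∉tail s∈ () | _ , _ , refl

  comparable : ∀ {F F′} → F ∈ₗ initialSegments (suc G) → F′ ∈ₗ initialSegments (suc G) →
    F ⊆ F′ ⊎ F′ ⊆ F
  comparable (here refl) _           = inj₁ ⊥⊆
  comparable (there _)   (here refl) = inj₂ ⊥⊆
  comparable (there F∈)  (there F′∈) = proj₂ tail-isChain F∈ F′∈

PairwiseIncomparableChains-∘ : {f : Fin n → Fin k} → Injective _≡_ _≡_ f →
  {D : Fin k → List (Subset G)} → PairwiseIncomparableChains D →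
  PairwiseIncomparableChains (D ∘ f)
PairwiseIncomparableChains-∘ {f = f} injective (chains , incomparable) =
  chains ∘ f , λ i j i≢j → incomparable (f i) (f j) (i≢j ∘ injective)

opposite-injective : Injective _≡_ _≡_ (opposite {n})
opposite-injective {x = i} {y = j} eq =
  trans (sym (opposite-involutive i)) (trans (cong opposite eq) (opposite-involutive j))

∸-suc-opposite : (i : Fin n) → n ∸ suc (toℕ (opposite i)) ≡ toℕ i
∸-suc-opposite i = trans (sym (opposite-prop (opposite i))) (cong toℕ (opposite-involutive i))

PairwiseIncomparableChains-∷ : {C : List (Subset G)} {D : Fin n → List (Subset G)} →
  IsChain C → (∀ i → Incomparable C (D i)) → PairwiseIncomparableChains D →
  PairwiseIncomparableChains (C ∷ᶠ D)
PairwiseIncomparableChains-∷ {C = C} {D} chain C∥D (chains , incomparable) =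
  chains′ , incomparable′
  where
  chains′ : ∀ i → IsChain ((C ∷ᶠ D) i)
  chains′ zero    = chain
  chains′ (suc i) = chains i

  incomparable′ : ∀ i j → ¬ (i ≡ j) → Incomparable ((C ∷ᶠ D) i) ((C ∷ᶠ D) j)
  incomparable′ zero    zero    0≢0 = contradiction refl 0≢0
  incomparable′ zero    (suc j) _   = C∥D j
  incomparable′ (suc i) zero    _   = Incomparable-sym (C∥D i)
  incomparable′ (suc i) (suc j) i≢j = incomparable i j (i≢j ∘ cong suc)

PairwiseIncomparableChains-prefix : (w : Vec Bool k) {D : Fin n → List (Subset G)} →
  PairwiseIncomparableChains D → PairwiseIncomparableChains (map (w ++_) ∘ D)
PairwiseIncomparableChains-prefix w (chains , incomparable) =
  IsChain-prefix w ∘ chains , λ i j i≢j → Incomparable-prefix w (incomparable i j i≢j)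

IncomparableChains : (G : ℕ) → (Fin n → ℕ) → Set
IncomparableChains G size =
  Σ (Fin _ → List (Subset G)) λ D → PairwiseIncomparableChains D × (∀ i → length (D i) ≡ size i)

ChainOfSize : (G L : ℕ) → Set
ChainOfSize G L = Σ (List (Subset G)) λ C → IsChain C × length C ≡ L

chainOfSize : ∀ {L} → L ≤ suc G → ChainOfSize G L
chainOfSize {G} {L} L≤1+G =
  take L (initialSegments G) ,
  IsChain-take L (initialSegments-isChain G) ,
  trans (length-take L (initialSegments G))
        (trans (cong (L ⊓_) (length-initialSegments G)) (m≤n⇒m⊓n≡m L≤1+G))

IncomparableChains-resize : {size size′ : Fin n → ℕ} → (∀ i → size i ≡ size′ i) →
  IncomparableChains G size → IncomparableChains G size′
IncomparableChains-resize size≗ (D , pic , sizes) = D , pic , λ i → trans (sizes i) (size≗ i)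

IncomparableChains-reverse : {size : Fin n → ℕ} →
  IncomparableChains G size → IncomparableChains G (size ∘ opposite)
IncomparableChains-reverse (D , pic , sizes) =
  D ∘ opposite , PairwiseIncomparableChains-∘ opposite-injective pic , sizes ∘ opposite

IncomparableChains-empty : {size : Fin 0 → ℕ} → IncomparableChains G size
IncomparableChains-empty = (λ ()) , ((λ ()) , λ ()) , λ ()

IncomparableChains-singleton : ∀ {L} → ChainOfSize G L → IncomparableChains G (λ (_ : Fin 1) → L)
IncomparableChains-singleton (C , chain , |C|) =
  (λ _ → C) , ((λ _ → chain) , λ { zero zero 0≢0 → contradiction refl 0≢0 }) , λ _ → |C|

w₁₀ w₀₁ : Vec Bool 2
w₁₀ = inside ∷ outside ∷ []
w₀₁ = outside ∷ inside ∷ []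

Incomparable-w₁₀-w₀₁ : {C D : List (Subset G)} → Incomparable (map (w₁₀ ++_) C) (map (w₀₁ ++_) D)
Incomparable-w₁₀-w₀₁ = Incomparable-map₂ (w₁₀ ++_) (w₀₁ ++_) λ _ _ →
  ⊈-witness here (λ ()) , ⊈-witness (there here) (λ { (there ()) })

IncomparableChains-stack : ∀ {L} {size : Fin n → ℕ} → ChainOfSize G L →
  IncomparableChains G size → IncomparableChains (2 + G) (L ∷ᶠ size)
IncomparableChains-stack (C , chain , |C|) (D , pic , sizes) =
  (map (w₁₀ ++_) C ∷ᶠ map (w₀₁ ++_) ∘ D) ,
  PairwiseIncomparableChains-∷ (IsChain-prefix w₁₀ chain) (λ _ → Incomparable-w₁₀-w₀₁)
    (PairwiseIncomparableChains-prefix w₀₁ pic) ,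
  λ { zero → trans (length-map _ C) |C| ; (suc i) → trans (length-map _ (D i)) (sizes i) }

arithmeticChains : 2 ≤ k → ∀ n {G} → 2 + k * n ≤ G →
  IncomparableChains G (λ (i : Fin (suc n)) → suc (k * (n ∸ toℕ i)))
arithmeticChains {k} _ zero _ =
  IncomparableChains-resize (λ { zero → cong suc (sym (*-zeroʳ k)) })
    (IncomparableChains-singleton (chainOfSize (s≤s z≤n)))
arithmeticChains {k} 2≤k (suc n) {suc (suc G)} (s≤s (s≤s k[1+n]≤G)) =
  IncomparableChains-resize (λ { zero → refl ; (suc i) → refl })
    (IncomparableChains-stack (chainOfSize (s≤s k[1+n]≤G))
      (arithmeticChains 2≤k n (begin
        2 + k * n     ≤⟨ +-monoˡ-≤ (k * n) 2≤k ⟩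
        k + k * n     ≡⟨ *-suc k n ⟨
        k * suc n     ≤⟨ k[1+n]≤G ⟩
        G             ∎)))
  where open ≤-Reasoning

MeetsHead : Subset (2 + G) → Set
MeetsHead s = zero ∈ s ⊎ suc zero ∈ s

DescendingChains : ℕ → Set
DescendingChains n =
  Σ (IncomparableChains (2 + n) (λ (i : Fin n) → suc (n ∸ suc (toℕ i)))) λ F →
    ∀ i → All MeetsHead (proj₁ F i)

w₁₀₁ : Vec Bool 3
w₁₀₁ = inside ∷ outside ∷ inside ∷ []

w₁₁₀₀ : Vec Bool 4
w₁₁₀₀ = inside ∷ inside ∷ outside ∷ outside ∷ []

Incomparable-w₁₀₁-w₁₁₀₀ : {C : List (Subset (suc G))} {D : List (Subset G)} →
  Incomparable (map (w₁₀₁ ++_) C) (map (w₁₁₀₀ ++_) D)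
Incomparable-w₁₀₁-w₁₁₀₀ = Incomparable-map₂ (w₁₀₁ ++_) (w₁₁₀₀ ++_) λ _ _ →
  ⊈-witness (there (there here)) (λ { (there (there ())) }) ,
  ⊈-witness (there here) (λ { (there ()) })

Incomparable-w₁₀₁-w₀₁ : {C : List (Subset (suc G))} {D : List (Subset (2 + G))} →
  Incomparable (map (w₁₀₁ ++_) C) (map (w₀₁ ++_) D)
Incomparable-w₁₀₁-w₀₁ = Incomparable-map₂ (w₁₀₁ ++_) (w₀₁ ++_) λ _ _ →
  ⊈-witness here (λ ()) , ⊈-witness (there here) (λ { (there ()) })

Incomparable-w₁₁₀₀-w₀₁ : {C : List (Subset G)} {D : List (Subset (2 + G))} →
  All MeetsHead D → Incomparable (map (w₁₁₀₀ ++_) C) (map (w₀₁ ++_) D)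
Incomparable-w₁₁₀₀-w₀₁ {G} meets = Incomparable-map₂ (w₁₁₀₀ ++_) (w₀₁ ++_) λ _ t∈ →
  ⊈-witness here (λ ()) , old⊈new (All.lookup meets t∈)
  where
  old⊈new : {s : Subset G} {t : Subset (2 + G)} → MeetsHead t → ¬ (w₀₁ ++ t ⊆ w₁₁₀₀ ++ s)
  old⊈new (inj₁ 0∈t) = ⊈-witness (there (there 0∈t)) (λ { (there (there ())) })
  old⊈new (inj₂ 1∈t) = ⊈-witness (there (there 1∈t)) (λ { (there (there (there ()))) })

descendingChains-step : DescendingChains n → DescendingChains (2 + n)
descendingChains-step {n} ((D , pic , sizes) , meets) =
  (A ∷ᶠ B ∷ᶠ old , pic′ , sizes′) , meets′
  where
  A : List (Subset (4 + n))
  A = map (w₁₀₁ ++_) (initialSegments (suc n))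

  B : List (Subset (4 + n))
  B = map (w₁₁₀₀ ++_) (initialSegments n)

  old : Fin n → List (Subset (4 + n))
  old = map (w₀₁ ++_) ∘ D

  pic′ : PairwiseIncomparableChains (A ∷ᶠ B ∷ᶠ old)
  pic′ = PairwiseIncomparableChains-∷ (IsChain-prefix w₁₀₁ (initialSegments-isChain (suc n)))
           (λ { zero → Incomparable-w₁₀₁-w₁₁₀₀ ; (suc _) → Incomparable-w₁₀₁-w₀₁ })
           (PairwiseIncomparableChains-∷ (IsChain-prefix w₁₁₀₀ (initialSegments-isChain n))
             (λ i → Incomparable-w₁₁₀₀-w₀₁ (meets i))
             (PairwiseIncomparableChains-prefix w₀₁ pic))

  sizes′ : ∀ i → length ((A ∷ᶠ B ∷ᶠ old) i) ≡ suc (2 + n ∸ suc (toℕ i))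
  sizes′ zero          =
    trans (length-map _ (initialSegments (suc n))) (length-initialSegments (suc n))
  sizes′ (suc zero)    = trans (length-map _ (initialSegments n)) (length-initialSegments n)
  sizes′ (suc (suc i)) = trans (length-map _ (D i)) (sizes i)

  meets′ : ∀ i → All MeetsHead ((A ∷ᶠ B ∷ᶠ old) i)
  meets′ zero          = All.map⁺ (All.universal (λ _ → inj₁ here) _)
  meets′ (suc zero)    = All.map⁺ (All.universal (λ _ → inj₁ here) _)
  meets′ (suc (suc i)) = All.map⁺ (All.universal (λ _ → inj₂ (there here)) _)

descendingChains : ∀ n → DescendingChains n
descendingChains zero          = IncomparableChains-empty , λ ()
descendingChains (suc zero)    = singleChain , λ { zero → inj₁ here All.∷ All.[] }
  where
  singleChain : IncomparableChains 3 (λ (i : Fin 1) → suc (1 ∸ suc (toℕ i)))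
  singleChain = IncomparableChains-resize (λ { zero → refl ; (suc ()) })
    (IncomparableChains-stack (chainOfSize {1} (s≤s z≤n)) (IncomparableChains-empty {size = λ ()}))
descendingChains (suc (suc n)) = descendingChains-step (descendingChains n)

mainTheorem5 : ((n : ℕ) → 2 ≤ n →
    Σ (Fin n → List (Subset (n + 2))) λ C →
    PairwiseIncomparableChains C × (∀ i → length (C i) ≡ suc (toℕ i)))
    ×
    ((n m : ℕ) → 2 ≤ n → 1 ≤ m → ((m ≡ 2 × n ≡ 2) ⊎ 3 ≤ m) →
    Σ (Fin n → List (Subset ((m ∸ 1) * (n ∸ 1) + 2))) λ C →
    PairwiseIncomparableChains C × (∀ i → length (C i) ≡ (m ∸ 1) * toℕ i + 1))
mainTheorem5 = partA , partB
  where
  -- (a) holds for every n.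
  partA : (n : ℕ) → 2 ≤ n → IncomparableChains (n + 2) (λ (i : Fin n) → suc (toℕ i))
  partA n _ = subst (λ G → IncomparableChains G (λ (i : Fin n) → suc (toℕ i))) (+-comm 2 n)
    (IncomparableChains-resize (cong suc ∘ ∸-suc-opposite)
      (IncomparableChains-reverse (proj₁ (descendingChains n))))

  partB : (n m : ℕ) → 2 ≤ n → 1 ≤ m → ((m ≡ 2 × n ≡ 2) ⊎ 3 ≤ m) →
    IncomparableChains ((m ∸ 1) * (n ∸ 1) + 2) (λ (i : Fin n) → (m ∸ 1) * toℕ i + 1)
  partB .2 .2 _ _ (inj₁ (refl , refl)) =
    IncomparableChains-resize (λ { zero → refl ; (suc zero) → refl })
      (IncomparableChains-reverse
        (IncomparableChains-stack (chainOfSize {1} (s≤s (s≤s z≤n)))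
          (IncomparableChains-singleton (chainOfSize {1} (s≤s z≤n)))))
  partB (suc n) (suc k) _ _ (inj₂ (s≤s 2≤k)) =
    IncomparableChains-resize
      (λ i → trans (cong (λ j → suc (k * j)) (∸-suc-opposite i)) (+-comm 1 (k * toℕ i)))
      (IncomparableChains-reverse (arithmeticChains 2≤k n (≤-reflexive (+-comm 2 (k * n)))))
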